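{- Let $s \ge 2$ and let $\Sigma = \{{\tt 0}, {\tt 1}, \ldots, s-1\}$, whose letters are identified with the base-$s$ digits. Let $m, n$ be integers with $0 < m < n < 2m$ and $\gcd(m,n) = 1$, and let $S = (\Sigma^m \cup \Sigma^n) \setminus T(m,n)$. Then $S^*$ is co-finite, and the longest words in $\Sigma^* \setminus S^*$ have length exactly $g(m,l) = ml - m - l$, where $l = m s^{n-m} + n - m$.
   Context: For integers $N \ge 0$, $k \ge 2$, $L \ge 1$ with $N < k^L$, $r(N, k, L)$ denotes the word of length $L$ over the digits $\{0,\ldots,k-1\}$ representing $N$ in base $k$, padded with leading zeros. For integers $0 < m < n$, $T(m,n) = \{ r(i, s, n-m)\,{\tt 0}^{2m-n}\, r(i+1, s, n-m) : 0 \le i \le s^{n-m} - 2 \}$. $\Sigma^j$ is the set of words of length $j$ over $\Sigma$; a language $L \subseteq \Sigma^*$ is co-finite if $\Sigma^* \setminus L$ is finite. -}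

module Defs where

open import Data.Nat using (ℕ; zero; suc; _+_; _*_; _∸_; _^_; _≤_; _<_; NonZero)
open import Data.Nat.DivMod using (_/_; _mod_)
open import Data.Fin using (Fin)
open import Data.List using (List; []; _∷_; _++_; [_]; replicate; length)
open import Data.List.Membership.Propositional using (_∈_)
open import Data.Product using (∃-syntax; _×_)
open import Data.Sum using (_⊎_)
open import Relation.Nullary using (¬_)
open import Relation.Binary.PropositionalEquality using (_≡_)

Word : ℕ → Set
Word s = List (Fin s)

digit0 : (s : ℕ) .{{_ : NonZero s}} → Fin s
digit0 s = 0 mod s

r : (N k L : ℕ) .{{_ : NonZero k}} → Word k
r N k zero    = []
r N k (suc L) = r (N / k) k L ++ [ N mod k ]

InT : (s : ℕ) .{{_ : NonZero s}} → (m n : ℕ) → Word s → Set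
InT s m n w =
  ∃[ i ] (i + 2 ≤ s ^ (n ∸ m)) ×
    (w ≡ r i s (n ∸ m) ++ replicate (2 * m ∸ n) (digit0 s) ++ r (suc i) s (n ∸ m))

InS : (s : ℕ) .{{_ : NonZero s}} → (m n : ℕ) → Word s → Set
InS s m n w = (length w ≡ m ⊎ length w ≡ n) × ¬ InT s m n w

data Star {A : Set} (P : List A → Set) : List A → Set where
  nil  : Star P []
  cons : ∀ {u v} → P u → Star P v → Star P (u ++ v)

CoFinite : {A : Set} → (List A → Set) → Set
CoFinite {A} P = ∃[ ws ] (∀ (w : List A) → ¬ P w → w ∈ ws)

-- g(m,l) = ml - m - l (nonnegative in the theorem's range)
g : ℕ → ℕ → ℕ
g m l = m * l ∸ m ∸ l

-- Write N = s^(n-m), z = 2m - n and l = (N - 1) m + n.  A word of length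
-- x m + y l can be cut into x + y (N - 1) factors of length m and y of length n,
-- and each n-factor may be chosen among the N windows at offsets 0, m, ..,
-- (N - 1) m of a stretch of length l.  Windows in T(m,n) at consecutive offsets
-- carry consecutive indices, because they overlap in a digit string r(i+1, s, n-m),
-- while T(m,n) has only N - 1 elements; so some window avoids T(m,n).  Since
-- gcd(m, l) = 1, every length above the Frobenius number g(m,l) is of this form.
-- Conversely, let W = r(0) 0^z r(1) 0^z ... 0^z r(N-1) and take W (0^m W)^(m-2),
-- of length g(m,l).  A factorization of it only visits positions k l + t m, and
-- an n-factor starting inside a copy of W lies in T(m,n), so it would have to
-- end at g(m,l) = k l + t m, which is not representable.

module Submission where

open import Defs
open import Data.Nat using (ℕ; zero; suc; pred; _+_; _*_; _∸_; _^_; _≤_; _<_; _≤?_; NonZero; >-nonZero; >-nonZero⁻¹; z≤n; s≤s)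
open import Data.Nat.Properties
open import Data.Nat.DivMod using (_/_; _%_; _mod_; m≡m%n+[m/n]*n; m%n<n; m<n*o⇒m/o<n)
open import Data.Nat.Divisibility using (_∣_; ∣-trans; ∣m∣n⇒∣m+n; ∣m+n∣m⇒∣n; m∣m*n; n∣m*n; ∣⇒≤)
open import Data.Nat.GCD using (gcd; module Bézout)
open import Data.Nat.Coprimality using (Coprime; gcd≡1⇒coprime; coprime-Bézout; coprime-divisor)
open import Data.Nat.Tactic.RingSolver using (solve-∀)
open import Data.Fin using (toℕ)
open import Data.Fin.Properties using (toℕ-fromℕ<)
open import Data.List using (List; []; _∷_; _++_; [_]; replicate; length; take; drop; foldl; allFin; cartesianProductWith)
open import Data.List.Properties
  using (length-++; length-replicate; length-take; length-drop; ++-assoc; ++-identityʳ; foldl-++; drop-drop; take++drop≡id)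
open import Data.List.Membership.Propositional using (_∈_)
open import Data.List.Membership.Propositional.Properties using (∈-cartesianProductWith⁺; ∈-allFin)
open import Data.List.Relation.Unary.Any using (here; there)
open import Data.Product using (∃-syntax; _×_; _,_)
open import Data.Sum using (_⊎_; inj₁; inj₂)
open import Data.Empty using (⊥; ⊥-elim)
open import Relation.Nullary using (¬_; Dec; yes; no)
open import Relation.Nullary.Decidable using (decidable-stable)
open import Relation.Binary.PropositionalEquality hiding ([_])

module _ {A : Set} where

  take-++ : ∀ {k} (xs ys : List A) → length xs ≡ k → take k (xs ++ ys) ≡ xs
  take-++ []       ys refl = refl
  take-++ (x ∷ xs) ys refl = cong (x ∷_) (take-++ xs ys refl)

  drop-++ : ∀ {k} (xs ys : List A) → length xs ≡ k → drop k (xs ++ ys) ≡ ys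
  drop-++ []       ys refl = refl
  drop-++ (x ∷ xs) ys refl = drop-++ xs ys refl

  ++-injectiveˡ : ∀ {xs ys zs ws : List A} → length xs ≡ length ys → xs ++ zs ≡ ys ++ ws → xs ≡ ys
  ++-injectiveˡ {xs} {ys} {zs} {ws} |xs|≡|ys| eq = begin
    xs                             ≡⟨ take-++ xs zs refl ⟨
    take (length xs) (xs ++ zs)    ≡⟨ cong₂ take |xs|≡|ys| eq ⟩
    take (length ys) (ys ++ ws)    ≡⟨ take-++ ys ws refl ⟩
    ys                             ∎
    where open ≡-Reasoning

  length-take-≤ : ∀ k (xs : List A) → k ≤ length xs → length (take k xs) ≡ k
  length-take-≤ k xs k≤ = trans (length-take k xs) (m≤n⇒m⊓n≡m k≤)

  length-drop-+ : ∀ j k (xs : List A) → length xs ≡ j + k → length (drop j xs) ≡ k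
  length-drop-+ j k xs eq = trans (length-drop j xs) (trans (cong (_∸ j) eq) (m+n∸m≡n j k))

  length≡0 : ∀ {xs : List A} → length xs ≡ 0 → xs ≡ []
  length≡0 {[]} _ = refl

star-take-drop : ∀ {A : Set} {P : List A → Set} k (w : List A) → P (take k w) → Star P (drop k w) → Star P w
star-take-drop k w p st = subst (Star _) (take++drop≡id k w) (cons p st)

module _ (s : ℕ) where

  words≤ : ℕ → List (Word s)
  words≤ zero    = [] ∷ []
  words≤ (suc k) = [] ∷ cartesianProductWith _∷_ (allFin s) (words≤ k)

  ∈-words≤ : ∀ k (w : Word s) → length w ≤ k → w ∈ words≤ k
  ∈-words≤ zero    []      _       = here refl
  ∈-words≤ (suc k) []      _       = here refl
  ∈-words≤ (suc k) (d ∷ w) (s≤s h) = there (∈-cartesianProductWith⁺ _∷_ (∈-allFin d) (∈-words≤ k w h))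

module _ (s : ℕ) .{{_ : NonZero s}} where

  fromDigits : Word s → ℕ
  fromDigits = foldl (λ acc d → acc * s + toℕ d) 0

  length-r : ∀ i L → length (r i s L) ≡ L
  length-r i zero    = refl
  length-r i (suc L) = trans (length-++ (r (i / s) s L)) (trans (cong (_+ 1) (length-r (i / s) L)) (+-comm L 1))

  fromDigits-r : ∀ L i → i < s ^ L → fromDigits (r i s L) ≡ i
  fromDigits-r zero    zero    _         = refl
  fromDigits-r zero    (suc i) (s≤s ())
  fromDigits-r (suc L) i       i<s^L+1 = begin
    fromDigits (r (i / s) s L ++ [ i mod s ]) ≡⟨ foldl-++ _ 0 (r (i / s) s L) [ i mod s ] ⟩
    fromDigits (r (i / s) s L) * s + toℕ (i mod s)
      ≡⟨ cong₂ (λ q d → q * s + d) (fromDigits-r L (i / s) i/s<s^L) (toℕ-fromℕ< (m%n<n i s)) ⟩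
    i / s * s + i % s ≡⟨ +-comm _ (i % s) ⟩
    i % s + i / s * s ≡⟨ m≡m%n+[m/n]*n i s ⟨
    i                 ∎
    where
    open ≡-Reasoning
    i/s<s^L : i / s < s ^ L
    i/s<s^L = m<n*o⇒m/o<n (subst (i <_) (*-comm s (s ^ L)) i<s^L+1)

  r-injective : ∀ L {i j} → i < s ^ L → j < s ^ L → r i s L ≡ r j s L → i ≡ j
  r-injective L {i} {j} i< j< eq = trans (sym (fromDigits-r L i i<)) (trans (cong fromDigits eq) (fromDigits-r L j j<))

module _ {a b : ℕ} .{{_ : NonZero a}} (a⊥b : Coprime a b) where

  frobenius-gap : ∀ x y → x * a + y * b + (a + b) ≢ a * b
  frobenius-gap x y eq = <⇒≱ [1+y]b<ab (*-monoˡ-≤ b a≤suc-y)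
    where
    split : suc x * a + suc y * b ≡ a * b
    split = trans (regroup x y a b) eq
      where
      regroup : ∀ x y a b → suc x * a + suc y * b ≡ x * a + y * b + (a + b)
      regroup = solve-∀
    a∣b*suc-y : a ∣ b * suc y
    a∣b*suc-y = subst (a ∣_) (*-comm (suc y) b)
                  (∣m+n∣m⇒∣n (subst (a ∣_) (sym split) (m∣m*n b)) (n∣m*n (suc x)))
    a≤suc-y : a ≤ suc y
    a≤suc-y = ∣⇒≤ (coprime-divisor a⊥b a∣b*suc-y)
    [1+y]b<ab : suc y * b < a * b
    [1+y]b<ab = subst (suc y * b <_) split (m<n+m (suc y * b) (≤-trans (>-nonZero⁻¹ a) (m≤m+n a (x * a))))

  inverse-mod : ∃[ c ] ∃[ A ] ∃[ B ] c * b + a * A ≡ 1 + a * B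
  inverse-mod with coprime-Bézout a⊥b
  ... | Bézout.-+ x y eq = y , 0 , x , (begin
    y * b + a * 0 ≡⟨ cong (y * b +_) (*-zeroʳ a) ⟩
    y * b + 0     ≡⟨ +-identityʳ (y * b) ⟩
    y * b         ≡⟨ eq ⟨
    1 + x * a     ≡⟨ cong suc (*-comm x a) ⟩
    1 + a * x     ∎)
    where open ≡-Reasoning
  -- here y b ≡ -1 (mod a), so (a - 1) y inverts b
  ... | Bézout.+- x y eq = a′ * y , 1 , a′ * x , (begin
    a′ * y * b + a * 1        ≡⟨ cong (λ k → a′ * y * b + k * 1) (sym (suc-pred a)) ⟩
    a′ * y * b + suc a′ * 1   ≡⟨ regroupˡ a′ y b ⟩
    suc (a′ * (1 + y * b))    ≡⟨ cong (λ k → suc (a′ * k)) eq ⟩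
    suc (a′ * (x * a))        ≡⟨ regroupʳ a′ x a ⟩
    1 + a * (a′ * x)          ∎)
    where
    open ≡-Reasoning
    a′ : ℕ
    a′ = pred a
    regroupˡ : ∀ a′ y b → a′ * y * b + suc a′ * 1 ≡ suc (a′ * (1 + y * b))
    regroupˡ = solve-∀
    regroupʳ : ∀ a′ x a → suc (a′ * (x * a)) ≡ 1 + a * (a′ * x)
    regroupʳ = solve-∀

  frobenius-representable : ∀ L → a * b < L + (a + b) → ∃[ x ] ∃[ y ] L ≡ x * a + y * b
  frobenius-representable L ab<L+a+b with inverse-mod
  ... | c , A , B , c-inverse = representation (B′ ≤? A′)
    where
    y A′ B′ : ℕ
    y = L * c % a
    A′ = L * c / a * b + L * A
    B′ = L * B

    congruence : y * b + a * A′ ≡ L + a * B′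
    congruence = begin
      y * b + a * A′                ≡⟨ regroupˡ y (L * c / a) a b L A ⟩
      (y + L * c / a * a) * b + a * (L * A) ≡⟨ cong (λ k → k * b + a * (L * A)) (m≡m%n+[m/n]*n (L * c) a) ⟨
      L * c * b + a * (L * A)       ≡⟨ regroupʳ L c b a A ⟩
      L * (c * b + a * A)           ≡⟨ cong (L *_) c-inverse ⟩
      L * (1 + a * B)               ≡⟨ regroupᵇ L a B ⟩
      L + a * B′                    ∎
      where
      open ≡-Reasoning
      regroupˡ : ∀ y q a b L A → y * b + a * (q * b + L * A) ≡ (y + q * a) * b + a * (L * A)
      regroupˡ = solve-∀
      regroupʳ : ∀ L c b a A → L * c * b + a * (L * A) ≡ L * (c * b + a * A)
      regroupʳ = solve-∀
      regroupᵇ : ∀ L a B → L * (1 + a * B) ≡ L + a * (L * B)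
      regroupᵇ = solve-∀

    representation : Dec (B′ ≤ A′) → ∃[ x ] ∃[ y ] L ≡ x * a + y * b
    representation (yes B′≤A′) with m≤n⇒∃[o]m+o≡n B′≤A′
    ... | x , B′+x≡A′ = x , y , +-cancelˡ-≡ (a * B′) L (x * a + y * b) (begin
      a * B′ + L                  ≡⟨ +-comm (a * B′) L ⟩
      L + a * B′                  ≡⟨ congruence ⟨
      y * b + a * A′              ≡⟨ cong (λ k → y * b + a * k) B′+x≡A′ ⟨
      y * b + a * (B′ + x)        ≡⟨ regroup y b a B′ x ⟩
      a * B′ + (x * a + y * b)    ∎)
      where
      open ≡-Reasoning
      regroup : ∀ y b a B x → y * b + a * (B + x) ≡ a * B + (x * a + y * b)
      regroup = solve-∀
    -- y b = L + a (1 + d) is impossible: with y < a it gives a b ≥ y b + b ≥ L + a + b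
    representation (no B′≰A′) with m≤n⇒∃[o]m+o≡n (≰⇒> B′≰A′)
    ... | d , A′+1+d≡B′ = ⊥-elim (<⇒≱ ab<L+a+b (begin
      L + (a + b)               ≤⟨ +-monoʳ-≤ L (+-monoˡ-≤ b (m≤m*n a (suc d))) ⟩
      L + (a * suc d + b)       ≡⟨ +-assoc L (a * suc d) b ⟨
      L + a * suc d + b         ≡⟨ cong (_+ b) yb≡L+a*suc-d ⟨
      y * b + b                 ≡⟨ +-comm (y * b) b ⟩
      suc y * b                 ≤⟨ *-monoˡ-≤ b (m%n<n (L * c) a) ⟩
      a * b                     ∎))
      where
      open ≤-Reasoning
      yb≡L+a*suc-d : y * b ≡ L + a * suc d
      yb≡L+a*suc-d = +-cancelˡ-≡ (a * A′) _ _ (begin-equality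
        a * A′ + y * b                ≡⟨ +-comm (a * A′) (y * b) ⟩
        y * b + a * A′                ≡⟨ congruence ⟩
        L + a * B′                    ≡⟨ cong (λ k → L + a * k) A′+1+d≡B′ ⟨
        L + a * (suc A′ + d)          ≡⟨ regroup L a A′ d ⟩
        a * A′ + (L + a * suc d)      ∎)
        where
        regroup : ∀ L a A d → L + a * (suc A + d) ≡ a * A + (L + a * suc d)
        regroup = solve-∀

m+n≤m*n : ∀ {m n} → 2 ≤ m → 2 ≤ n → m + n ≤ m * n
m+n≤m*n {suc (suc m′)} {suc (suc n′)} (s≤s (s≤s z≤n)) (s≤s (s≤s z≤n)) =
  subst (2 + m′ + (2 + n′) ≤_) (sym (expand m′ n′)) (m≤m+n _ _)
  where
  expand : ∀ m′ n′ → (2 + m′) * (2 + n′) ≡ 2 + m′ + (2 + n′) + (m′ + n′ + m′ * n′)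
  expand = solve-∀

g+[m+n]≡m*n : ∀ {m n} → 2 ≤ m → 2 ≤ n → g m n + (m + n) ≡ m * n
g+[m+n]≡m*n {m} {n} 2≤m 2≤n =
  trans (cong (_+ (m + n)) (∸-+-assoc (m * n) m n)) (m∸n+n≡m (m+n≤m*n 2≤m 2≤n))

module _ (s : ℕ) .{{_ : NonZero s}} {m n : ℕ} (m<n : m < n) (n<2m : n < 2 * m) (gcd≡1 : gcd m n ≡ 1) where

  private
    p z N M l : ℕ
    p = n ∸ m
    z = 2 * m ∸ n
    N = s ^ p
    M = N ∸ 1
    l = m * N + p

    P : Word s → Set
    P = InS s m n

    code : ℕ → Word s
    code i = r i s p

    zeros : ℕ → Word s
    zeros k = replicate k (digit0 s)

    cell : ℕ → Word s
    cell i = code i ++ zeros z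

    block : ℕ → Word s
    block i = code i ++ zeros z ++ code (suc i)

  m+p≡n : m + p ≡ n
  m+p≡n = m+[n∸m]≡n (<⇒≤ m<n)

  p+z≡m : p + z ≡ m
  p+z≡m = +-cancelˡ-≡ m _ _ (begin
    m + (p + z)  ≡⟨ +-assoc m p z ⟨
    m + p + z    ≡⟨ cong (_+ z) m+p≡n ⟩
    n + z        ≡⟨ m+[n∸m]≡n (<⇒≤ n<2m) ⟩
    m + (m + 0)  ≡⟨ cong (m +_) (+-identityʳ m) ⟩
    m + m        ∎)
    where open ≡-Reasoning

  2≤m : 2 ≤ m
  2≤m = subst (2 ≤_) p+z≡m (+-mono-≤ (m<n⇒0<n∸m m<n) (m<n⇒0<n∸m n<2m))

  N≡1+M : N ≡ suc M
  N≡1+M = sym (m+[n∸m]≡n (m^n>0 s p))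

  M*m+p+m≡l : M * m + p + m ≡ l
  M*m+p+m≡l = begin
    M * m + p + m   ≡⟨ regroup M m p ⟩
    m * suc M + p   ≡⟨ cong (λ k → m * k + p) N≡1+M ⟨
    l               ∎
    where
    open ≡-Reasoning
    regroup : ∀ M m p → M * m + p + m ≡ m * suc M + p
    regroup = solve-∀

  l≡M*m+n : l ≡ M * m + n
  l≡M*m+n = begin
    l                ≡⟨ M*m+p+m≡l ⟨
    M * m + p + m    ≡⟨ +-assoc (M * m) p m ⟩
    M * m + (p + m)  ≡⟨ cong (M * m +_) (trans (+-comm p m) m+p≡n) ⟩
    M * m + n        ∎
    where open ≡-Reasoning

  2≤l : 2 ≤ l
  2≤l = subst (2 ≤_) (sym l≡M*m+n) (≤-trans (≤-trans 2≤m (<⇒≤ m<n)) (m≤n+m n (M * m)))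

  m⊥l : Coprime m l
  m⊥l {d} (d∣m , d∣l) = gcd≡1⇒coprime gcd≡1 (d∣m , subst (d ∣_) m+p≡n (∣m∣n⇒∣m+n d∣m d∣p))
    where
    d∣p : d ∣ p
    d∣p = ∣m+n∣m⇒∣n d∣l (∣-trans d∣m (m∣m*n N))

  g+[m+l]≡m*l : g m l + (m + l) ≡ m * l
  g+[m+l]≡m*l = g+[m+n]≡m*n 2≤m 2≤l

  length-code : ∀ i → length (code i) ≡ p
  length-code i = length-r s i p

  length-cell : ∀ i → length (cell i) ≡ m
  length-cell i = trans (length-++ (code i)) (trans (cong₂ _+_ (length-code i) (length-replicate z)) p+z≡m)

  length-block : ∀ i → length (block i) ≡ n
  length-block i = begin
    length (block i)                          ≡⟨ cong length (++-assoc (code i) (zeros z) (code (suc i))) ⟨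
    length (cell i ++ code (suc i))           ≡⟨ length-++ (cell i) ⟩
    length (cell i) + length (code (suc i))   ≡⟨ cong₂ _+_ (length-cell i) (length-code (suc i)) ⟩
    m + p                                     ≡⟨ m+p≡n ⟩
    n                                         ∎
    where open ≡-Reasoning

  InT⇒length≡n : ∀ {u} → InT s m n u → length u ≡ n
  InT⇒length≡n (i , _ , refl) = length-block i

  length≡m⇒InS : ∀ {u} → length u ≡ m → InS s m n u
  length≡m⇒InS |u|≡m = inj₁ |u|≡m , λ u∈T → <⇒≢ m<n (trans (sym |u|≡m) (InT⇒length≡n u∈T))

  blocks : ℕ → ℕ → Word s
  blocks i zero    = code i
  blocks i (suc c) = cell i ++ blocks (suc i) c

  W : Word s
  W = blocks 0 M

  repeatW : ℕ → Word s
  repeatW zero    = W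
  repeatW (suc c) = (W ++ zeros m) ++ repeatW c

  length-blocks : ∀ i c → length (blocks i c) ≡ c * m + p
  length-blocks i zero    = length-code i
  length-blocks i (suc c) = begin
    length (cell i ++ blocks (suc i) c)               ≡⟨ length-++ (cell i) ⟩
    length (cell i) + length (blocks (suc i) c)       ≡⟨ cong₂ _+_ (length-cell i) (length-blocks (suc i) c) ⟩
    m + (c * m + p)                                   ≡⟨ +-assoc m (c * m) p ⟨
    suc c * m + p                                     ∎
    where open ≡-Reasoning

  length-W+zeros : length (W ++ zeros m) ≡ l
  length-W+zeros = begin
    length (W ++ zeros m)           ≡⟨ length-++ W ⟩
    length W + length (zeros m)     ≡⟨ cong₂ _+_ (length-blocks 0 M) (length-replicate m) ⟩
    M * m + p + m                   ≡⟨ M*m+p+m≡l ⟩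
    l                               ∎
    where open ≡-Reasoning

  length-repeatW : ∀ c → length (repeatW c) ≡ c * l + (M * m + p)
  length-repeatW zero    = length-blocks 0 M
  length-repeatW (suc c) = begin
    length ((W ++ zeros m) ++ repeatW c)                ≡⟨ length-++ (W ++ zeros m) ⟩
    length (W ++ zeros m) + length (repeatW c)          ≡⟨ cong₂ _+_ length-W+zeros (length-repeatW c) ⟩
    l + (c * l + (M * m + p))                           ≡⟨ +-assoc l (c * l) _ ⟨
    suc c * l + (M * m + p)                             ∎
    where open ≡-Reasoning

  blocks-start : ∀ i c → ∃[ v ] blocks i c ≡ code i ++ v
  blocks-start i zero    = [] , sym (++-identityʳ (code i))
  blocks-start i (suc c) = zeros z ++ blocks (suc i) c , ++-assoc (code i) (zeros z) _

  block-start : ∀ i c → ∃[ v ] blocks i (suc c) ≡ block i ++ v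
  block-start i c with blocks-start (suc i) c
  ... | v , eq = v , (begin
    cell i ++ blocks (suc i) c         ≡⟨ cong (cell i ++_) eq ⟩
    cell i ++ code (suc i) ++ v        ≡⟨ ++-assoc (cell i) (code (suc i)) v ⟨
    (cell i ++ code (suc i)) ++ v      ≡⟨ cong (_++ v) (++-assoc (code i) (zeros z) (code (suc i))) ⟩
    block i ++ v                       ∎)
    where open ≡-Reasoning

  repeatW-start : ∀ c → ∃[ v ] repeatW c ≡ W ++ v
  repeatW-start zero    = [] , sym (++-identityʳ W)
  repeatW-start (suc c) = zeros m ++ repeatW c , ++-assoc W (zeros m) (repeatW c)

  drop-blocks : ∀ t i c rest → drop (t * m) (blocks i (t + c) ++ rest) ≡ blocks (i + t) c ++ rest
  drop-blocks zero    i c rest = cong (λ j → blocks j c ++ rest) (sym (+-identityʳ i))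
  drop-blocks (suc t) i c rest = begin
    drop (m + t * m) ((cell i ++ blocks (suc i) (t + c)) ++ rest)    ≡⟨ cong (drop (m + t * m)) (++-assoc (cell i) _ rest) ⟩
    drop (m + t * m) (cell i ++ blocks (suc i) (t + c) ++ rest)      ≡⟨ drop-drop m (t * m) _ ⟨
    drop (t * m) (drop m (cell i ++ blocks (suc i) (t + c) ++ rest)) ≡⟨ cong (drop (t * m)) (drop-++ (cell i) _ (length-cell i)) ⟩
    drop (t * m) (blocks (suc i) (t + c) ++ rest)                    ≡⟨ drop-blocks t (suc i) c rest ⟩
    blocks (suc i + t) c ++ rest                                     ≡⟨ cong (λ j → blocks j c ++ rest) (+-suc i t) ⟨
    blocks (i + suc t) c ++ rest                                     ∎
    where open ≡-Reasoning

  drop-repeatW : ∀ k c → drop (k * l) (repeatW (k + c)) ≡ repeatW c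
  drop-repeatW zero    c = refl
  drop-repeatW (suc k) c = begin
    drop (l + k * l) ((W ++ zeros m) ++ repeatW (k + c))           ≡⟨ drop-drop l (k * l) _ ⟨
    drop (k * l) (drop l ((W ++ zeros m) ++ repeatW (k + c)))      ≡⟨ cong (drop (k * l)) (drop-++ (W ++ zeros m) _ length-W+zeros) ⟩
    drop (k * l) (repeatW (k + c))                                 ≡⟨ drop-repeatW k c ⟩
    repeatW c                                                      ∎
    where open ≡-Reasoning

  repeatW-at : ∀ k d t c → t + suc c ≡ M → ∃[ v ] drop (k * l + t * m) (repeatW (k + d)) ≡ block t ++ v
  repeatW-at k d t c t+1+c≡M with repeatW-start d | block-start t c
  ... | w , repeatW-d≡W++w | v , blocks-t≡block++v = v ++ w , (begin
    drop (k * l + t * m) (repeatW (k + d))          ≡⟨ drop-drop (k * l) (t * m) _ ⟨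
    drop (t * m) (drop (k * l) (repeatW (k + d)))   ≡⟨ cong (drop (t * m)) (drop-repeatW k d) ⟩
    drop (t * m) (repeatW d)                        ≡⟨ cong (drop (t * m)) repeatW-d≡W++w ⟩
    drop (t * m) (blocks 0 M ++ w)                  ≡⟨ cong (λ c′ → drop (t * m) (blocks 0 c′ ++ w)) t+1+c≡M ⟨
    drop (t * m) (blocks 0 (t + suc c) ++ w)        ≡⟨ drop-blocks t 0 (suc c) w ⟩
    blocks t (suc c) ++ w                           ≡⟨ cong (_++ w) blocks-t≡block++v ⟩
    (block t ++ v) ++ w                             ≡⟨ ++-assoc (block t) v w ⟩
    block t ++ v ++ w                               ∎)
    where open ≡-Reasoning

  witness : Word s
  witness = repeatW (m ∸ 2)

  length-witness : length witness ≡ g m l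
  length-witness = +-cancelʳ-≡ (m + l) _ _ (begin
    length witness + (m + l)                 ≡⟨ cong (_+ (m + l)) (length-repeatW (m ∸ 2)) ⟩
    (m ∸ 2) * l + (M * m + p) + (m + l)      ≡⟨ regroup ((m ∸ 2) * l) (M * m + p) m l ⟩
    (m ∸ 2) * l + (M * m + p + m) + l        ≡⟨ cong (λ k → (m ∸ 2) * l + k + l) M*m+p+m≡l ⟩
    (m ∸ 2) * l + l + l                      ≡⟨ regroup′ (m ∸ 2) l ⟩
    (2 + (m ∸ 2)) * l                        ≡⟨ cong (_* l) (m+[n∸m]≡n 2≤m) ⟩
    m * l                                    ≡⟨ g+[m+l]≡m*l ⟨
    g m l + (m + l)                          ∎)
    where
    open ≡-Reasoning
    regroup : ∀ a b c d → a + b + (c + d) ≡ a + (b + c) + d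
    regroup = solve-∀
    regroup′ : ∀ a l → a * l + l + l ≡ (2 + a) * l
    regroup′ = solve-∀

  k*l≤g⇒k≤m∸2 : ∀ {k} → k * l ≤ g m l → k ≤ m ∸ 2
  k*l≤g⇒k≤m∸2 {k} k*l≤g = ≮⇒≥ λ m∸2<k → n≮n _ (begin-strict
    g m l + (m + l)         ≡⟨ g+[m+l]≡m*l ⟩
    m * l                   ≡⟨ cong (_* l) (m+[n∸m]≡n 2≤m) ⟨
    (2 + (m ∸ 2)) * l       ≡⟨ +-comm l _ ⟩
    suc (m ∸ 2) * l + l     ≤⟨ +-monoˡ-≤ l (*-monoˡ-≤ l m∸2<k) ⟩
    k * l + l               ≤⟨ +-monoˡ-≤ l k*l≤g ⟩
    g m l + l               <⟨ +-monoʳ-< (g m l) (m<n+m l (≤-trans (s≤s z≤n) 2≤m)) ⟩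
    g m l + (m + l)         ∎)
    where open ≤-Reasoning

  witness-at : ∀ k t → k * l + t * m ≤ g m l → t < M → ∃[ v ] drop (k * l + t * m) witness ≡ block t ++ v
  witness-at k t q≤g t<M with m≤n⇒∃[o]m+o≡n (k*l≤g⇒k≤m∸2 {k} (≤-trans (m≤m+n (k * l) (t * m)) q≤g))
                        | m≤n⇒∃[o]m+o≡n t<M
  ... | d , k+d≡m∸2 | c , 1+t+c≡M =
    subst (λ w → ∃[ v ] drop (k * l + t * m) w ≡ block t ++ v) (cong repeatW k+d≡m∸2)
      (repeatW-at k d t c (trans (+-suc t c) 1+t+c≡M))

  private instance
    m≢0 : NonZero m
    m≢0 = >-nonZero (≤-trans (s≤s z≤n) 2≤m)

  suffix-not-in-star : ∀ {v} → Star P v → ∀ k t →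
    drop (k * l + t * m) witness ≡ v → k * l + t * m + length v ≡ g m l → ⊥
  suffix-not-in-star nil k t _ q+0≡g = frobenius-gap m⊥l t k (begin
    t * m + k * l + (m + l)   ≡⟨ cong (_+ (m + l)) (trans (+-comm (t * m) (k * l)) (trans (sym (+-identityʳ _)) q+0≡g)) ⟩
    g m l + (m + l)           ≡⟨ g+[m+l]≡m*l ⟩
    m * l                     ∎)
    where open ≡-Reasoning
  suffix-not-in-star (cons {u} {v} (|u|≡m⊎n , u∉T) v∈S*) k t drop-q≡u++v q+|u++v|≡g = next |u|≡m⊎n
    where
    open ≡-Reasoning
    q : ℕ
    q = k * l + t * m

    drop-q+|u|≡v : drop (q + length u) witness ≡ v
    drop-q+|u|≡v = trans (sym (drop-drop q (length u) witness))
                     (trans (cong (drop (length u)) drop-q≡u++v) (drop-++ u v refl))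

    q+|u|+|v|≡g : q + length u + length v ≡ g m l
    q+|u|+|v|≡g = trans (+-assoc q (length u) (length v)) (trans (cong (q +_) (sym (length-++ u))) q+|u++v|≡g)

    continue-at : ∀ k′ t′ → k′ * l + t′ * m ≡ q + length u → ⊥
    continue-at k′ t′ eq = suffix-not-in-star v∈S* k′ t′
      (subst (λ i → drop i witness ≡ v) (sym eq) drop-q+|u|≡v)
      (trans (cong (_+ length v) eq) q+|u|+|v|≡g)

    next : length u ≡ m ⊎ length u ≡ n → ⊥
    next (inj₁ |u|≡m) = continue-at k (suc t) (begin
      k * l + (m + t * m)    ≡⟨ regroup (k * l) m (t * m) ⟩
      q + m                  ≡⟨ cong (q +_) |u|≡m ⟨
      q + length u           ∎)
      where
      regroup : ∀ a b c → a + (b + c) ≡ a + c + b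
      regroup = solve-∀
    next (inj₂ |u|≡n) with M ≤? t
    ... | yes M≤t with m≤n⇒∃[o]m+o≡n M≤t
    ...   | t′ , M+t′≡t = continue-at (suc k) t′ (begin
      l + k * l + t′ * m             ≡⟨ cong (λ j → j + k * l + t′ * m) l≡M*m+n ⟩
      M * m + n + k * l + t′ * m     ≡⟨ regroup M m n (k * l) t′ ⟩
      k * l + (M + t′) * m + n       ≡⟨ cong₂ (λ j i → k * l + j * m + i) M+t′≡t (sym |u|≡n) ⟩
      q + length u                   ∎)
      where
      regroup : ∀ M m n a t → M * m + n + a + t * m ≡ a + (M + t) * m + n
      regroup = solve-∀
    next (inj₂ |u|≡n) | no M≰t with witness-at k t q≤g (≰⇒> M≰t)
      where
      q≤g : q ≤ g m l
      q≤g = subst (q ≤_) q+|u|+|v|≡g (≤-trans (m≤m+n q (length u)) (m≤m+n _ (length v)))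
    ... | v′ , drop-q≡block++v′ = u∉T (t , t+2≤N , ++-injectiveˡ (trans |u|≡n (sym (length-block t)))
                                                       (trans (sym drop-q≡u++v) drop-q≡block++v′))
      where
      t+2≤N : t + 2 ≤ N
      t+2≤N = subst₂ _≤_ (+-comm 2 t) (sym N≡1+M) (s≤s (≰⇒> M≰t))

  longest-non-member : ∃[ w ] (length w ≡ g m l × ¬ Star P w)
  longest-non-member = witness , length-witness , λ witness∈S* → suffix-not-in-star witness∈S* 0 0 refl length-witness

  Window : Word s → ℕ → Set
  Window v i = (i + 2 ≤ N) × (take n v ≡ block i)

  take≡block⇒prefix : ∀ {v i} → take n v ≡ block i → ∃[ x ] v ≡ code i ++ x
  take≡block⇒prefix {v} {i} take≡block = (zeros z ++ code (suc i)) ++ drop n v , (begin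
    v                                                 ≡⟨ take++drop≡id n v ⟨
    take n v ++ drop n v                              ≡⟨ cong (_++ drop n v) take≡block ⟩
    block i ++ drop n v                               ≡⟨ ++-assoc (code i) _ (drop n v) ⟩
    code i ++ (zeros z ++ code (suc i)) ++ drop n v   ∎)
    where open ≡-Reasoning

  take≡block⇒drop-m : ∀ {v i} → take n v ≡ block i → drop m v ≡ code (suc i) ++ drop n v
  take≡block⇒drop-m {v} {i} take≡block = begin
    drop m v                                        ≡⟨ cong (drop m) (take++drop≡id n v) ⟨
    drop m (take n v ++ drop n v)                   ≡⟨ cong (λ x → drop m (x ++ drop n v)) take≡block ⟩
    drop m (block i ++ drop n v)                    ≡⟨ cong (λ x → drop m (x ++ drop n v)) (++-assoc (code i) (zeros z) (code (suc i))) ⟨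
    drop m ((cell i ++ code (suc i)) ++ drop n v)   ≡⟨ cong (drop m) (++-assoc (cell i) (code (suc i)) (drop n v)) ⟩
    drop m (cell i ++ code (suc i) ++ drop n v)     ≡⟨ drop-++ (cell i) _ (length-cell i) ⟩
    code (suc i) ++ drop n v                        ∎
    where open ≡-Reasoning

  window-successor : ∀ {v i i′} → Window v i → Window (drop m v) i′ → i′ ≡ suc i
  window-successor {v} {i} {i′} (i+2≤N , take≡block) (i′+2≤N , take≡block′) with take≡block⇒prefix take≡block′
  ... | x , drop-m≡code++x = sym (r-injective s p (subst (_≤ N) (+-comm i 2) i+2≤N)
                                                  (≤-trans (n≤1+n _) (subst (_≤ N) (+-comm i′ 2) i′+2≤N))
                                 (++-injectiveˡ (trans (length-code (suc i)) (sym (length-code i′)))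
                                                (trans (sym (take≡block⇒drop-m take≡block)) drop-m≡code++x)))

  -- Membership in T(m,n) is not decided here; the windows are only known to be
  -- in T up to double negation, which suffices since every use ends in ⊥.
  window-run : ∀ c v i → Window v i → (∀ j → j ≤ c → ¬ ¬ InT s m n (take n (drop (j * m) v))) → i + c + 2 ≤ N
  window-run zero    v i (i+2≤N , _) _ = subst (λ j → j + 2 ≤ N) (sym (+-identityʳ i)) i+2≤N
  window-run (suc c) v i window in-T = decidable-stable (i + suc c + 2 ≤? N) λ ¬bound →
    in-T′ 0 z≤n λ { (i′ , window′) → ¬bound (subst (λ j → j + 2 ≤ N)
      (trans (cong (_+ c) (window-successor window window′)) (sym (+-suc i c)))
      (window-run c (drop m v) i′ window′ in-T′)) }
    where
    in-T′ : ∀ j → j ≤ c → ¬ ¬ InT s m n (take n (drop (j * m) (drop m v)))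
    in-T′ j j≤c = subst (λ w → ¬ ¬ InT s m n (take n w)) (sym (drop-drop m (j * m) v)) (in-T (suc j) (s≤s j≤c))

  star-after-m-blocks : ∀ j w → j * m ≤ length w → Star P (drop (j * m) w) → Star P w
  star-after-m-blocks zero    w _       rest∈S* = rest∈S*
  star-after-m-blocks (suc j) w jm+m≤|w| rest∈S* =
    star-take-drop m w (length≡m⇒InS (length-take-≤ m w (m+n≤o⇒m≤o m jm+m≤|w|)))
      (star-after-m-blocks j (drop m w) jm≤|drop-m-w| (subst (Star P) (sym (drop-drop m (j * m) w)) rest∈S*))
    where
    jm≤|drop-m-w| : j * m ≤ length (drop m w)
    jm≤|drop-m-w| = subst (j * m ≤_) (sym (length-drop m w))
                      (m+n≤o⇒m≤o∸n (j * m) (subst (_≤ length w) (+-comm m (j * m)) jm+m≤|w|))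

  star-of-length : ∀ k b w → length w ≡ k * n + (k * M + b) * m → ¬ ¬ Star P w
  star-of-length zero b w |w|≡bm w∉S* =
    w∉S* (star-after-m-blocks b w (≤-reflexive (sym |w|≡bm)) (subst (Star P) (sym drop-bm≡[]) nil))
    where
    drop-bm≡[] : drop (b * m) w ≡ []
    drop-bm≡[] = length≡0 (length-drop-+ (b * m) 0 w (trans |w|≡bm (sym (+-identityʳ _))))
  star-of-length (suc k) b w length-w w∉S* = window-in-T 0 z≤n λ { (i , window) →
    n≮n (suc M) (begin-strict
      suc M            <⟨ n<1+n (suc M) ⟩
      2 + M            ≡⟨ +-comm 2 M ⟩
      M + 2            ≤⟨ m≤n+m (M + 2) i ⟩
      i + (M + 2)      ≡⟨ +-assoc i M 2 ⟨
      i + M + 2        ≤⟨ window-run M w i window window-in-T ⟩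
      N                ≡⟨ N≡1+M ⟩
      suc M            ∎) }
    where
    open ≤-Reasoning
    window-in-T : ∀ j → j ≤ M → ¬ ¬ InT s m n (take n (drop (j * m) w))
    window-in-T j j≤M u∉T with m≤n⇒∃[o]m+o≡n j≤M
    ... | d , j+d≡M = star-of-length k (d + b) rest |rest|≡ λ rest∈S* →
      w∉S* (star-after-m-blocks j w (subst (j * m ≤_) (sym |w|≡jm+n+Y) (m≤m+n (j * m) (n + Y)))
             (star-take-drop n (drop (j * m) w) (inj₂ |window|≡n , u∉T) rest∈S*))
      where
      Y : ℕ
      Y = k * n + (k * M + (d + b)) * m
      rest : Word s
      rest = drop n (drop (j * m) w)
      |w|≡jm+n+Y : length w ≡ j * m + (n + Y)
      |w|≡jm+n+Y = begin-equality
        length w                                                          ≡⟨ length-w ⟩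
        suc k * n + (suc k * M + b) * m                                   ≡⟨ cong (λ x → suc k * n + (suc k * x + b) * m) j+d≡M ⟨
        suc k * n + (suc k * (j + d) + b) * m                             ≡⟨ regroup k n j d b m ⟩
        j * m + (n + (k * n + (k * (j + d) + (d + b)) * m))               ≡⟨ cong (λ x → j * m + (n + (k * n + (k * x + (d + b)) * m))) j+d≡M ⟩
        j * m + (n + Y)                                                   ∎
        where
        regroup : ∀ k n j d b m →
          suc k * n + (suc k * (j + d) + b) * m ≡ j * m + (n + (k * n + (k * (j + d) + (d + b)) * m))
        regroup = solve-∀
      |drop|≡n+Y : length (drop (j * m) w) ≡ n + Y
      |drop|≡n+Y = length-drop-+ (j * m) (n + Y) w |w|≡jm+n+Y
      |window|≡n : length (take n (drop (j * m) w)) ≡ n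
      |window|≡n = length-take-≤ n _ (subst (n ≤_) (sym |drop|≡n+Y) (m≤m+n n Y))
      |rest|≡ : length rest ≡ Y
      |rest|≡ = length-drop-+ n Y (drop (j * m) w) |drop|≡n+Y

  non-member-length-≤ : ∀ w → ¬ Star P w → length w ≤ g m l
  non-member-length-≤ w w∉S* = ≮⇒≥ λ g<|w| →
    let x , y , |w|≡xm+yl = frobenius-representable m⊥l (length w)
                              (subst (_< length w + (m + l)) g+[m+l]≡m*l (+-monoˡ-< (m + l) g<|w|))
    in star-of-length y x w (trans |w|≡xm+yl (trans (cong (λ k → x * m + y * k) l≡M*m+n) (regroup x m y M n))) w∉S*
    where
    regroup : ∀ x m y M n → x * m + y * (M * m + n) ≡ y * n + (y * M + x) * m
    regroup = solve-∀

theorem23 : (s : ℕ) .{{_ : NonZero s}} → 2 ≤ s →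
    (m n : ℕ) → 0 < m → m < n → n < 2 * m → gcd m n ≡ 1 →
    CoFinite (Star (InS s m n))
    × (∃[ w ] (length w ≡ g m (m * s ^ (n ∸ m) + (n ∸ m)) × ¬ Star (InS s m n) w))
    × (∀ (w : Word s) → ¬ Star (InS s m n) w → length w ≤ g m (m * s ^ (n ∸ m) + (n ∸ m)))
theorem23 s _ m n _ m<n n<2m gcd≡1 =
  (words≤ s _ , λ w w∉S* → ∈-words≤ s _ w (non-member-length-≤ s m<n n<2m gcd≡1 w w∉S*))
  , longest-non-member s m<n n<2m gcd≡1
  , non-member-length-≤ s m<n n<2m gcd≡1
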